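{- Let $A,B,C,D$ be sets with $B$ and $D$ finite, let $f:A+C\to B+D$ be a bijection and $g:C\to D$ a bijection. Let $f\setminus g:A\to B$ be the subtraction of $g$ from $f$, and let $f\setminus(f\setminus g):C\to D$ be the subtraction of $f\setminus g$ from $f$, regarding $f$ as a bijection $C+A\to D+B$ (both defined in the context). Then \[ f\setminus(f\setminus g)=g \iff \forall x\in C\;\bigl(f(x)\in D\implies g(x)=f(x)\bigr).\]
   Context: $+$ denotes disjoint union. Subtraction: given sets $X_1,X_2,Y_1,Y_2$ with $Y_2$ finite, a bijection $\varphi:X_1+X_2\to Y_1+Y_2$ and a bijection $\psi:X_2\to Y_2$, $(\varphi\setminus\psi)(x)$ for $x\in X_1$ is computed by: set $y:=\varphi(x)$; while $y\in Y_2$, set $y:=\varphi(\psi^{ -1}(y))$; return $y$. It is known that this loop terminates and $\varphi\setminus\psi$ is a bijection $X_1\to Y_1$. The condition on the right-hand side is expressed by saying $g$ respects $f$. -}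

module Defs where

open import Data.Nat using (ℕ; zero; suc; _+_)
open import Data.Nat.Properties using (m≤n⇒∃[o]m+o≡n)
open import Data.Fin using (Fin; toℕ)
open import Data.Fin.Properties using (pigeonhole)
open import Data.Sum using (_⊎_; inj₁; inj₂)
open import Data.Product using (Σ; Σ-syntax; _,_; _×_; proj₁; proj₂)
open import Data.Empty using (⊥; ⊥-elim)
open import Function using (_∘_)
open import Function.Bundles using (_↔_; Inverse; mk↔ₛ′)
open import Relation.Binary.PropositionalEquality
  using (_≡_; refl; sym; trans; cong; subst)

Finite : Set → Set
Finite Y = Σ ℕ λ n → Y ↔ Fin n

-- The loop of the subtraction, described for plain functions
--   F : X₁ + X₂ → Y₁ + Y₂   (the map φ)
--   G : Y₂ → X₂              (the map ψ⁻¹)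
-- `Run y b` means: running the while loop starting with the current
-- value y, the loop stops and returns b.

module Loop {X₁ X₂ Y₁ Y₂ : Set} (F : X₁ ⊎ X₂ → Y₁ ⊎ Y₂) (G : Y₂ → X₂) where

  step : Y₂ → Y₁ ⊎ Y₂
  step d = F (inj₂ (G d))

  data Run : Y₁ ⊎ Y₂ → Y₁ → Set where
    done : ∀ {b} → Run (inj₁ b) b
    more : ∀ {d b} → Run (step d) b → Run (inj₂ d) b

  Run-det : ∀ {y b b′} → Run y b → Run y b′ → b ≡ b′
  Run-det done done = refl
  Run-det (more r) (more r′) = Run-det r r′

  next : Y₁ ⊎ Y₂ → Y₁ ⊎ Y₂
  next (inj₁ b) = inj₁ b
  next (inj₂ d) = step d

  iter : ℕ → Y₁ ⊎ Y₂ → Y₁ ⊎ Y₂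
  iter zero y = y
  iter (suc k) y = next (iter k y)

  Run-next : ∀ y {b} → Run (next y) b → Run y b
  Run-next (inj₁ _) r = r
  Run-next (inj₂ _) r = more r

  Run-iter : ∀ k y {b} → Run (iter k y) b → Run y b
  Run-iter zero y r = r
  Run-iter (suc k) y r = Run-iter k y (Run-next (iter k y) r)

  next-inj₂ : ∀ y {d} → next y ≡ inj₂ d → Σ[ d′ ∈ Y₂ ] (y ≡ inj₂ d′ × step d′ ≡ inj₂ d)
  next-inj₂ (inj₁ b) ()
  next-inj₂ (inj₂ d′) eq = d′ , refl , eq

module Termination {X₁ X₂ Y₁ Y₂ : Set}
  (φ : (X₁ ⊎ X₂) ↔ (Y₁ ⊎ Y₂)) (ψ : X₂ ↔ Y₂) (n : ℕ) (code : Y₂ → Fin n)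
  (code-inj : ∀ {d d′} → code d ≡ code d′ → d ≡ d′) where

  open Inverse φ renaming (to to φt; from to φf)
  open Inverse ψ renaming (to to ψt; from to ψf; strictlyInverseˡ to ψˡ)
  open Loop φt ψf

  φ-inj : ∀ {z z′} → φt z ≡ φt z′ → z ≡ z′
  φ-inj {z} {z′} eq = trans (sym (Inverse.strictlyInverseʳ φ z))
                        (trans (cong φf eq) (Inverse.strictlyInverseʳ φ z′))

  step-inj : ∀ {d d′} → step d ≡ step d′ → d ≡ d′
  step-inj {d} {d′} eq with φ-inj eq
  ... | e = trans (sym (ψˡ d)) (trans (cong ψt (inj₂-inj e)) (ψˡ d′))
    where
    inj₂-inj : ∀ {a b : X₂} → _≡_ {A = X₁ ⊎ X₂} (inj₂ a) (inj₂ b) → a ≡ b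
    inj₂-inj refl = refl

  module _ (x : X₁) where
    s : ℕ → Y₁ ⊎ Y₂
    s k = iter k (φt (inj₁ x))

    descend : ∀ a k d → s a ≡ inj₂ d → s (a + suc k) ≡ inj₂ d → ⊥
    descend zero k d e₁ e₂ with next-inj₂ (s k) e₂
    ... | d′ , _ , e₃ with φ-inj (trans e₁ (sym e₃))
    ... | ()
    descend (suc a) k d e₁ e₂ with next-inj₂ (s a) e₁ | next-inj₂ (s (a + suc k)) e₂
    ... | d₁ , f₁ , g₁ | d₂ , f₂ , g₂ =
      descend a k d₁ f₁ (trans f₂ (cong inj₂ (sym (step-inj (trans g₁ (sym g₂))))))

    down : ∀ k m {d} → s (k + m) ≡ inj₂ d → Σ[ d′ ∈ Y₂ ] s m ≡ inj₂ d′
    down zero m {d} e = d , e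
    down (suc k) m e with next-inj₂ (s (k + m)) e
    ... | d′ , f , _ = down k m f

    getD : (y : Y₁ ⊎ Y₂) → Σ[ d ∈ Y₂ ] y ≡ inj₂ d → Y₂
    getD _ (d , _) = d

    terminates : Σ[ b ∈ Y₁ ] Run (φt (inj₁ x)) b
    terminates with s n in eqn
    ... | inj₁ b = b , Run-iter n (φt (inj₁ x)) (subst (λ y → Run y b) (sym eqn) done)
    ... | inj₂ d = ⊥-elim contra
      where
      open import Data.Fin.Properties using (toℕ≤n; toℕ<n)
      open import Data.Nat using (_≤_; _<_; s≤s)
      open import Data.Nat.Properties using (+-comm)
      all : (i : Fin (suc n)) → Σ[ d′ ∈ Y₂ ] s (toℕ i) ≡ inj₂ d′
      all i with m≤n⇒∃[o]m+o≡n (Data.Nat.Properties.≤-pred (toℕ<n i))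
      ... | o , eq = down o (toℕ i) (subst (λ t → s t ≡ inj₂ d)
                        (trans (sym eq) (+-comm (toℕ i) o)) eqn)
      h : Fin (suc n) → Fin n
      h i = code (proj₁ (all i))
      contra : ⊥
      contra with pigeonhole (s≤s (Data.Nat.Properties.≤-refl)) h
      ... | i , j , i<j , hij with m≤n⇒∃[o]m+o≡n i<j
      ... | o , eq =
        descend (toℕ i) o (proj₁ (all i)) (proj₂ (all i))
          (subst (λ t → s t ≡ inj₂ (proj₁ (all i)))
             (trans (sym eq) (sym (Data.Nat.Properties.+-suc (toℕ i) o)))
             (trans (proj₂ (all j)) (cong inj₂ (sym (code-inj hij)))))

-- Reversal of runs: a run of the loop for (φ, ψ) gives a run for (φ⁻¹, ψ⁻¹).

module Reverse {X₁ X₂ Y₁ Y₂ : Set}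
  (φ : (X₁ ⊎ X₂) ↔ (Y₁ ⊎ Y₂)) (ψ : X₂ ↔ Y₂) where
  open Inverse φ renaming (to to φt; from to φf)
  open Inverse ψ renaming (to to ψt; from to ψf)
  module L  = Loop φt ψf
  module L′ = Loop φf ψt

  rev : ∀ {y b} → L.Run y b → ∀ z → φt z ≡ y → ∀ {x} → L′.Run z x → L′.Run (φf (inj₁ b)) x
  rev {b = b} L.done z e r = subst (λ w → L′.Run w _)
    (trans (sym (Inverse.strictlyInverseʳ φ z)) (cong φf e)) r
  rev (L.more {d} r₀) z e r = rev r₀ (inj₂ (ψf d)) refl
    (L′.more (subst (λ w → L′.Run w _)
      (trans (sym (Inverse.strictlyInverseʳ φ z))
             (trans (cong φf e) (cong (λ t → φf (inj₂ t)) (sym (Inverse.strictlyInverseˡ ψ d))))) r))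

-- Subtraction φ ∖ ψ : X₁ ↔ Y₁ of ψ : X₂ ↔ Y₂ from φ : X₁ + X₂ ↔ Y₁ + Y₂,
-- Y₂ finite.  (φ ∖ ψ)(x) is the output of the loop
--   y := φ(x); while y ∈ Y₂ do y := φ(ψ⁻¹(y)); return y.

module _ {X₁ X₂ Y₁ Y₂ : Set} (finY₂ : Finite Y₂)
  (φ : (X₁ ⊎ X₂) ↔ (Y₁ ⊎ Y₂)) (ψ : X₂ ↔ Y₂) where

  private
    n = proj₁ finY₂
    e = proj₂ finY₂
    code : Y₂ → Fin n
    code = Inverse.to e
    code-inj : ∀ {d d′} → code d ≡ code d′ → d ≡ d′
    code-inj {d} {d′} eq = trans (sym (Inverse.strictlyInverseʳ e d))
      (trans (cong (Inverse.from e) eq) (Inverse.strictlyInverseʳ e d′))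
    code′ : X₂ → Fin n
    code′ = code ∘ Inverse.to ψ
    code′-inj : ∀ {c c′} → code′ c ≡ code′ c′ → c ≡ c′
    code′-inj {c} {c′} eq = trans (sym (Inverse.strictlyInverseʳ ψ c))
      (trans (cong (Inverse.from ψ) (code-inj eq)) (Inverse.strictlyInverseʳ ψ c′))
    φ⁻ : (Y₁ ⊎ Y₂) ↔ (X₁ ⊎ X₂)
    φ⁻ = mk↔ₛ′ (Inverse.from φ) (Inverse.to φ)
           (Inverse.strictlyInverseʳ φ) (Inverse.strictlyInverseˡ φ)
    ψ⁻ : Y₂ ↔ X₂
    ψ⁻ = mk↔ₛ′ (Inverse.from ψ) (Inverse.to ψ)
           (Inverse.strictlyInverseʳ ψ) (Inverse.strictlyInverseˡ ψ)
    module T  = Termination φ ψ n code code-inj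
    module T′ = Termination φ⁻ ψ⁻ n code′ code′-inj
    module R  = Reverse φ ψ
    module R′ = Reverse φ⁻ ψ⁻
    module L  = Loop (Inverse.to φ) (Inverse.from ψ)
    module L′ = Loop (Inverse.from φ) (Inverse.to ψ)

    sub-to : X₁ → Y₁
    sub-to x = proj₁ (T.terminates x)
    sub-from : Y₁ → X₁
    sub-from b = proj₁ (T′.terminates b)

    invʳ : ∀ x → sub-from (sub-to x) ≡ x
    invʳ x = L′.Run-det (proj₂ (T′.terminates (sub-to x)))
               (R.rev (proj₂ (T.terminates x)) (inj₁ x) refl L′.done)
    invˡ : ∀ b → sub-to (sub-from b) ≡ b
    invˡ b = L.Run-det (proj₂ (T.terminates (sub-from b)))
               (R′.rev (proj₂ (T′.terminates b)) (inj₁ b) refl L.done)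

  subtract : X₁ ↔ Y₁
  subtract = mk↔ₛ′ sub-to sub-from invˡ invʳ

swap⊎ : {P Q : Set} → P ⊎ Q → Q ⊎ P
swap⊎ (inj₁ p) = inj₂ p
swap⊎ (inj₂ q) = inj₁ q

swap⊎-inv : {P Q : Set} (z : P ⊎ Q) → swap⊎ (swap⊎ z) ≡ z
swap⊎-inv (inj₁ _) = refl
swap⊎-inv (inj₂ _) = refl

flip↔ : {A B C D : Set} → (A ⊎ C) ↔ (B ⊎ D) → (C ⊎ A) ↔ (D ⊎ B)
flip↔ f = mk↔ₛ′ (swap⊎ ∘ Inverse.to f ∘ swap⊎) (swap⊎ ∘ Inverse.from f ∘ swap⊎)
  (λ y → trans (cong swap⊎ (trans (cong (Inverse.to f) (swap⊎-inv _))
                                  (Inverse.strictlyInverseˡ f _))) (swap⊎-inv y))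
  (λ x → trans (cong swap⊎ (trans (cong (Inverse.from f) (swap⊎-inv _))
                                  (Inverse.strictlyInverseʳ f _))) (swap⊎-inv x))

{-# OPTIONS --safe #-}
-- If g respects f, the loop computing f ∖ g leaves D after at most one
-- step: were d ↦ f(g⁻¹ d) to land in D again, respect would force it to
-- return to d itself, and a run through a fixed point never ends.  Now let
-- f(x) = b ∈ B and a = (f ∖ g)⁻¹(b).  Then f(a) = d ∈ D (as a ≠ x), so the
-- one-step property gives f(g⁻¹ d) = b = f(x), whence g(x) = d; and the loop
-- for f ∖ (f ∖ g) at x goes b ↦ f(a) = d, so it returns g(x) as well.
-- The converse is immediate: when f(x) ∈ D that loop stops at once.
module Submission where

open import Defs
open import Data.Fin using (Fin)
open import Data.Sum using (_⊎_; inj₁; inj₂)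
open import Data.Sum.Properties using (inj₂-injective)
open import Data.Product using (proj₁; proj₂)
open import Data.Empty using (⊥-elim)
open import Function using (_∘_)
open import Function.Bundles using (_↔_; Inverse; Injection; _⇔_; mk⇔)
open import Function.Properties.Inverse using (Inverse⇒Injection)
open import Relation.Binary.PropositionalEquality

to-injective : {P Q : Set} (f : P ↔ Q) → ∀ {z z′} → Inverse.to f z ≡ Inverse.to f z′ → z ≡ z′
to-injective f = Injection.injective (Inverse⇒Injection f)

Respects : {X₁ X₂ Y₁ Y₂ : Set} → X₂ ↔ Y₂ → (X₁ ⊎ X₂) ↔ (Y₁ ⊎ Y₂) → Set
Respects {X₂ = X₂} {Y₂ = Y₂} ψ φ =
  ∀ (x : X₂) (d : Y₂) → Inverse.to φ (inj₂ x) ≡ inj₂ d → Inverse.to ψ x ≡ d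

module _ {X₁ X₂ Y₁ Y₂ : Set} {F : X₁ ⊎ X₂ → Y₁ ⊎ Y₂} {G : Y₂ → X₂} where
  open Loop F G

  Run-stop : ∀ {y b} → y ≡ inj₁ b → Run y b
  Run-stop refl = done

  Run-avoids-fixed-point : ∀ {d} → step d ≡ inj₂ d → ∀ {y b} → Run y b → y ≢ inj₂ d
  Run-avoids-fixed-point fix done ()
  Run-avoids-fixed-point fix (more r) refl = Run-avoids-fixed-point fix r fix

module _ {X₁ X₂ Y₁ Y₂ : Set} (φ : (X₁ ⊎ X₂) ↔ (Y₁ ⊎ Y₂)) (ψ : X₂ ↔ Y₂) where
  open Loop (Inverse.to φ) (Inverse.from ψ)

  respects⇒step-fixed : Respects ψ φ → ∀ {d d′} → step d ≡ inj₂ d′ → step d ≡ inj₂ d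
  respects⇒step-fixed resp {d} e =
    trans e (cong inj₂ (trans (sym (resp _ _ e)) (Inverse.strictlyInverseˡ ψ d)))

  respects⇒Run-one-step : Respects ψ φ → ∀ {d b} → Run (inj₂ d) b → step d ≡ inj₁ b
  respects⇒Run-one-step resp {d} (more r) with step d in e
  ... | inj₁ _ with done ← r = refl
  ... | inj₂ _ = ⊥-elim (Run-avoids-fixed-point fix r (trans (sym e) fix))
    where
    fix : step d ≡ inj₂ d
    fix = respects⇒step-fixed resp e

module _ {X₁ X₂ Y₁ Y₂ : Set} (fin : Finite Y₂)
  (φ : (X₁ ⊎ X₂) ↔ (Y₁ ⊎ Y₂)) (ψ : X₂ ↔ Y₂) where
  open Loop (Inverse.to φ) (Inverse.from ψ)

  private
    σ : X₁ ↔ Y₁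
    σ = subtract fin φ ψ

  -- The injectivity witness must be the very term used inside `subtract`,
  -- so that the loop result below is definitionally its output.
  subtract-Run : ∀ x → Run (Inverse.to φ (inj₁ x)) (Inverse.to σ x)
  subtract-Run = proj₂ ∘ Termination.terminates φ ψ (proj₁ fin) code code-injective
    where
    code : Y₂ → Fin (proj₁ fin)
    code = Inverse.to (proj₂ fin)
    code-injective : ∀ {d d′} → code d ≡ code d′ → d ≡ d′
    code-injective {d} {d′} eq = trans (sym (Inverse.strictlyInverseʳ (proj₂ fin) d))
      (trans (cong (Inverse.from (proj₂ fin)) eq) (Inverse.strictlyInverseʳ (proj₂ fin) d′))

  Run⇒subtract : ∀ {x b} → Run (Inverse.to φ (inj₁ x)) b → Inverse.to σ x ≡ b
  Run⇒subtract = Run-det (subtract-Run _)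

  subtract-immediate : ∀ {x b} → Inverse.to φ (inj₁ x) ≡ inj₁ b → Inverse.to σ x ≡ b
  subtract-immediate e = Run⇒subtract (Run-stop e)

  subtract-after-one-step : ∀ {x d b} → Inverse.to φ (inj₁ x) ≡ inj₂ d →
    Inverse.to φ (inj₂ (Inverse.from ψ d)) ≡ inj₁ b → Inverse.to σ x ≡ b
  subtract-after-one-step {b = b} e e′ =
    Run⇒subtract (subst (λ y → Run y b) (sym e) (more (Run-stop e′)))

  respects⇒subtract-one-step : Respects ψ φ → ∀ {x d} → Inverse.to φ (inj₁ x) ≡ inj₂ d →
    Inverse.to φ (inj₂ (Inverse.from ψ d)) ≡ inj₁ (Inverse.to σ x)
  respects⇒subtract-one-step resp {x} e =
    respects⇒Run-one-step φ ψ resp (subst (λ y → Run y (Inverse.to σ x)) e (subtract-Run x))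

  respects⇒φ-subtract⁻¹ : Respects ψ φ → ∀ {x b} → Inverse.to φ (inj₂ x) ≡ inj₁ b →
    Inverse.to φ (inj₁ (Inverse.from σ b)) ≡ inj₂ (Inverse.to ψ x)
  respects⇒φ-subtract⁻¹ resp {x} {b} e with Inverse.to φ (inj₁ (Inverse.from σ b)) in e′
  ... | inj₁ _ with () ← to-injective φ (trans e′ (trans (cong inj₁
          (trans (sym (subtract-immediate e′)) (Inverse.strictlyInverseˡ σ b))) (sym e)))
  ... | inj₂ d = cong inj₂ (sym (trans (cong (Inverse.to ψ) x≡ψ⁻¹d) (Inverse.strictlyInverseˡ ψ d)))
    where
    x≡ψ⁻¹d : x ≡ Inverse.from ψ d
    x≡ψ⁻¹d = inj₂-injective (to-injective φ (trans e (sym (trans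
      (respects⇒subtract-one-step resp e′) (cong inj₁ (Inverse.strictlyInverseˡ σ b))))))

proposition5 : {A B C D : Set} (finB : Finite B) (finD : Finite D)
    (f : (A ⊎ C) ↔ (B ⊎ D)) (g : C ↔ D) →
    ((∀ x → Inverse.to (subtract finB (flip↔ f) (subtract finD f g)) x ≡ Inverse.to g x)
    ⇔ (∀ x d → Inverse.to f (inj₂ x) ≡ inj₂ d → Inverse.to g x ≡ d))
proposition5 {A} {B} {C} {D} finB finD f g = mk⇔ respected respects⇒k≗g
  where
  h : A ↔ B
  h = subtract finD f g
  k : C ↔ D
  k = subtract finB (flip↔ f) h

  respected : (∀ x → Inverse.to k x ≡ Inverse.to g x) → Respects g f
  respected k≗g x d e = trans (sym (k≗g x)) (subtract-immediate finB (flip↔ f) h (cong swap⊎ e))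

  respects⇒k≗g : Respects g f → ∀ x → Inverse.to k x ≡ Inverse.to g x
  respects⇒k≗g resp x = by-image (Inverse.to f (inj₂ x)) refl
    where
    by-image : ∀ y → Inverse.to f (inj₂ x) ≡ y → Inverse.to k x ≡ Inverse.to g x
    by-image (inj₁ b) e = subtract-after-one-step finB (flip↔ f) h
      (cong swap⊎ e) (cong swap⊎ (respects⇒φ-subtract⁻¹ finD f g resp e))
    by-image (inj₂ d) e =
      trans (subtract-immediate finB (flip↔ f) h (cong swap⊎ e)) (sym (resp x d e))
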